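{- Let $M$ be an $m \times n$ Boolean matrix that is $(d,e;u)$-disjunct. Then for every distinct $d$-sparse vectors $x, x' \in \{0,1\}^n$ such that $\mathrm{supp}(x) \nsubseteq \mathrm{supp}(x')$, $\mathrm{wgt}(x) \geq |\mathrm{supp}(x') \setminus \mathrm{supp}(x)|$ and $\mathrm{wgt}(x) \geq u$, we have \[ |\mathrm{supp}(M[x]_u) \setminus \mathrm{supp}(M[x']_u)| > e. \] Conversely, if $M$ satisfies this inequality for every pair of distinct $d$-sparse vectors $x, x' \in \{0,1\}^n$ with $\mathrm{supp}(x) \nsubseteq \mathrm{supp}(x')$, $\mathrm{wgt}(x) \geq |\mathrm{supp}(x') \setminus \mathrm{supp}(x)|$ and $\mathrm{wgt}(x) \geq u$, then $M$ must be $(\lfloor d/2 \rfloor,e;u)$-disjunct.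
   Context: Gap-free threshold group testing with threshold $u$ (lower threshold equals upper threshold). For $x \in \{0,1\}^n$, $\mathrm{supp}(x)$ is the set of nonzero coordinates, $\mathrm{wgt}(x) = |\mathrm{supp}(x)|$, and $x$ is $d$-sparse if $\mathrm{wgt}(x) \leq d$. For an $m \times n$ Boolean matrix $M$ with rows $M_1,\dots,M_m$, $M[x]_u \in \{0,1\}^m$ is the outcome vector with $j$th entry $1$ iff $|\mathrm{supp}(M_j) \cap \mathrm{supp}(x)| \geq u$. $M|_S$ denotes the restriction of $M$ to the columns in $S$. $M$ is $(d,e;u)$-disjunct if for every critical set $S \subseteq [n]$ and zero set $Z \subseteq [n]$ with $u \leq |S| \leq d$, $|Z| \leq |S|$, $S \cap Z = \emptyset$, and every distinguished column $i \in S$, there are more than $e$ rows of $M$ at which $M|_S$ has weight exactly $u$, $M|_Z$ has weight zero, and the $i$th column has a $1$. -}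

module Defs where

open import Data.Nat using (ℕ; _≤_; _<_; _≤ᵇ_; _/_)
open import Data.Bool using (Bool; true; false; _∧_)
open import Data.Fin using (Fin)
open import Data.Vec using (Vec; map; tabulate; lookup)
open import Data.Fin.Subset using (Subset; ∣_∣; _∩_; _─_; _⊆_; _∈_; ⊥)
open import Data.Nat using (_≡ᵇ_)
open import Relation.Binary.PropositionalEquality using (_≡_; _≢_)
open import Relation.Nullary using (¬_)

-- A Boolean vector in {0,1}^n is represented as a Subset n (= Vec Bool n);
-- its support is the subset itself, and wgt x = ∣ x ∣.
BVec : ℕ → Set
BVec = Subset

wgt : ∀ {n} → BVec n → ℕ
wgt x = ∣ x ∣

Sparse : ∀ {n} → ℕ → BVec n → Set
Sparse d x = wgt x ≤ d

BMat : ℕ → ℕ → Set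
BMat m n = Vec (BVec n) m

outcome : ∀ {m n} → BMat m n → BVec n → ℕ → BVec m
outcome M x u = map (λ row → u ≤ᵇ ∣ row ∩ x ∣) M

goodRows : ∀ {m n} → BMat m n → ℕ → Subset n → Subset n → Fin n → Subset m
goodRows M u S Z i =
  map (λ row → (∣ row ∩ S ∣ ≡ᵇ u) ∧ ((∣ row ∩ Z ∣ ≡ᵇ 0) ∧ lookup row i)) M

Disjunct : ∀ {m n} → ℕ → ℕ → ℕ → BMat m n → Set
Disjunct {m} {n} d e u M =
  (S Z : Subset n) → u ≤ ∣ S ∣ → ∣ S ∣ ≤ d → ∣ Z ∣ ≤ ∣ S ∣ → S ∩ Z ≡ ⊥ →
  (i : Fin n) → i ∈ S → e < ∣ goodRows M u S Z i ∣

Separating : ∀ {m n} → ℕ → ℕ → ℕ → BMat m n → Set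
Separating {m} {n} d e u M =
  (x x′ : BVec n) → Sparse d x → Sparse d x′ → x ≢ x′ → ¬ (x ⊆ x′) →
  ∣ x′ ─ x ∣ ≤ wgt x → u ≤ wgt x →
  e < ∣ outcome M x u ─ outcome M x′ u ∣

-- Forward: pick i ∈ x ∖ x′ and apply disjunctness to S = x, Z = x′ ∖ x. A good row meets x in
-- exactly u columns, one of them i ∉ x′, and misses x′ ∖ x, so it meets x′ in fewer than u
-- columns: it is positive for x and negative for x′.
-- Backward: given S, Z and i ∈ S, separate x = S from x′ = (S ∪ Z) ∖ {i}, which is d-sparse as
-- ∣S∣ + ∣Z∣ ≤ 2⌊d/2⌋. A row positive for S and negative for x′ must contain i (otherwise it would
-- meet x′ at least as much as S), and then ∣row ∩ S∣ + ∣row ∩ Z∣ ≤ 1 + ∣row ∩ x′∣ ≤ u, which forces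
-- ∣row ∩ S∣ = u and row ∩ Z = ∅.
module Submission where

open import Defs
open import Data.Bool using (Bool; T; _∧_)
open import Data.Bool.Properties using (T-≡; T-∧)
open import Data.Fin using (Fin; _≟_)
open import Data.Fin.Properties using (¬∀⟶∃¬)
open import Data.Fin.Subset
  using (Subset; inside; outside; ∣_∣; _∩_; _∪_; _─_; _-_; ⁅_⁆; ⊥; _∈_; _∉_; _⊆_; _⊈_; _⊂_; Empty)
open import Data.Fin.Subset.Properties
open import Data.Nat using (ℕ; suc; _+_; _/_; _≤_; _<_; _≡ᵇ_)
open import Data.Nat.Properties
  using (≤-reflexive; ≤-trans; ≤-antisym; <-≤-trans; <⇒≱; ≰⇒>; m≤m+n; +-suc; +-identityʳ; +-mono-≤;
         +-monoʳ-≤; +-cancelˡ-≤; n≤0⇒n≡0; *-comm; ≤ᵇ⇒≤; ≤⇒≤ᵇ; ≡ᵇ⇒≡; ≡⇒≡ᵇ; module ≤-Reasoning)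
open import Data.Nat.DivMod using (m/n*n≤m; m/n≤m)
open import Data.Product using (∃; _×_; _,_; proj₁; proj₂)
open import Data.Sum using ([_,_]; inj₁; inj₂)
open import Data.Vec using (Vec; []; _∷_; lookup; map; here; there)
open import Data.Vec.Properties using (lookup-map; []=⇒lookup; lookup⇒[]=)
open import Function using (_∘_; const; flip; id)
open import Function.Bundles using (_⇔_; mk⇔; Equivalence)
open import Relation.Binary.PropositionalEquality
  using (_≡_; _≢_; refl; sym; trans; cong; cong₂; subst; module ≡-Reasoning)
open import Relation.Nullary using (yes; no; contradiction)
open import Relation.Nullary.Decidable using (_→-dec_; decidable-stable)

open Equivalence using (to; from)

private
  variable
    n : ℕ
    p q r : Subset n
    x : Fin n

x∈p─q⇒x∉q : ∀ (p q : Subset n) → x ∈ p ─ q → x ∉ q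
x∈p─q⇒x∉q (_ ∷ p) (_ ∷ q) (there x∈p─q) (there x∈q) = x∈p─q⇒x∉q p q x∈p─q x∈q
x∈p─q⇒x∉q (_ ∷ p) (inside ∷ q) () here

∈─⇔ : x ∈ p ─ q ⇔ (x ∈ p × x ∉ q)
∈─⇔ {p = p} {q} = mk⇔ (λ x∈p─q → p─q⊆p p q x∈p─q , x∈p─q⇒x∉q p q x∈p─q)
                      (λ (x∈p , x∉q) → x∈p∧x∉q⇒x∈p─q x∈p x∉q)

⊈-witness : p ⊈ q → ∃ λ x → x ∈ p × x ∉ q
⊈-witness {n} {p} {q} p⊈q
  with ¬∀⟶∃¬ n (λ x → x ∈ p → x ∈ q) (λ x → x ∈? p →-dec x ∈? q) (λ p⊆q → p⊈q (p⊆q _))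
... | x , x∈p↛x∈q =
  x , decidable-stable (x ∈? p) (λ x∉p → x∈p↛x∈q (λ x∈p → contradiction x∈p x∉p))
    , x∈p↛x∈q ∘ const

p∩[q─p]≡⊥ : ∀ (p q : Subset n) → p ∩ (q ─ p) ≡ ⊥
p∩[q─p]≡⊥ p q = Empty-unique λ (x , x∈p∩[q─p]) →
  let x∈p , x∈q─p = x∈p∩q⁻ p (q ─ p) x∈p∩[q─p] in x∈p─q⇒x∉q q p x∈q─p x∈p

∣p∪q∣+∣p∩q∣≡∣p∣+∣q∣ : ∀ (p q : Subset n) → ∣ p ∪ q ∣ + ∣ p ∩ q ∣ ≡ ∣ p ∣ + ∣ q ∣
∣p∪q∣+∣p∩q∣≡∣p∣+∣q∣ []              []              = refl
∣p∪q∣+∣p∩q∣≡∣p∣+∣q∣ (inside  ∷ p)  (inside  ∷ q)  =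
  cong suc (trans (+-suc _ _) (trans (cong suc (∣p∪q∣+∣p∩q∣≡∣p∣+∣q∣ p q)) (sym (+-suc _ _))))
∣p∪q∣+∣p∩q∣≡∣p∣+∣q∣ (inside  ∷ p)  (outside ∷ q)  = cong suc (∣p∪q∣+∣p∩q∣≡∣p∣+∣q∣ p q)
∣p∪q∣+∣p∩q∣≡∣p∣+∣q∣ (outside ∷ p)  (inside  ∷ q)  = trans (cong suc (∣p∪q∣+∣p∩q∣≡∣p∣+∣q∣ p q)) (sym (+-suc _ _))
∣p∪q∣+∣p∩q∣≡∣p∣+∣q∣ (outside ∷ p)  (outside ∷ q)  = ∣p∪q∣+∣p∩q∣≡∣p∣+∣q∣ p q

∣p∪q∣≤∣p∣+∣q∣ : ∀ (p q : Subset n) → ∣ p ∪ q ∣ ≤ ∣ p ∣ + ∣ q ∣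
∣p∪q∣≤∣p∣+∣q∣ p q = subst (∣ p ∪ q ∣ ≤_) (∣p∪q∣+∣p∩q∣≡∣p∣+∣q∣ p q) (m≤m+n _ _)

Empty[p∩q]⇒∣p∪q∣≡∣p∣+∣q∣ : ∀ (p q : Subset n) → Empty (p ∩ q) → ∣ p ∪ q ∣ ≡ ∣ p ∣ + ∣ q ∣
Empty[p∩q]⇒∣p∪q∣≡∣p∣+∣q∣ {n} p q p∩q-empty = begin
  ∣ p ∪ q ∣                  ≡⟨ sym (+-identityʳ _) ⟩
  ∣ p ∪ q ∣ + 0              ≡⟨ cong (∣ p ∪ q ∣ +_) (sym ∣p∩q∣≡0) ⟩
  ∣ p ∪ q ∣ + ∣ p ∩ q ∣      ≡⟨ ∣p∪q∣+∣p∩q∣≡∣p∣+∣q∣ p q ⟩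
  ∣ p ∣ + ∣ q ∣              ∎
  where
  open ≡-Reasoning
  ∣p∩q∣≡0 : ∣ p ∩ q ∣ ≡ 0
  ∣p∩q∣≡0 = trans (cong ∣_∣ (Empty-unique p∩q-empty)) (∣⊥∣≡0 n)

p∩q≡⊥⇒∣r∩p∣+∣r∩q∣≡∣r∩[p∪q]∣ : ∀ (r p q : Subset n) → p ∩ q ≡ ⊥ → ∣ r ∩ p ∣ + ∣ r ∩ q ∣ ≡ ∣ r ∩ (p ∪ q) ∣
p∩q≡⊥⇒∣r∩p∣+∣r∩q∣≡∣r∩[p∪q]∣ r p q p∩q≡⊥ = begin
  ∣ r ∩ p ∣ + ∣ r ∩ q ∣      ≡⟨ sym (Empty[p∩q]⇒∣p∪q∣≡∣p∣+∣q∣ (r ∩ p) (r ∩ q) disjoint) ⟩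
  ∣ (r ∩ p) ∪ (r ∩ q) ∣      ≡⟨ cong ∣_∣ (sym (∩-distribˡ-∪ r p q)) ⟩
  ∣ r ∩ (p ∪ q) ∣            ∎
  where
  open ≡-Reasoning
  disjoint : Empty ((r ∩ p) ∩ (r ∩ q))
  disjoint (x , x∈) =
    let x∈r∩p , x∈r∩q = x∈p∩q⁻ (r ∩ p) (r ∩ q) x∈
    in ∉⊥ (subst (x ∈_) p∩q≡⊥ (x∈p∩q⁺ (proj₂ (x∈p∩q⁻ r p x∈r∩p) , proj₂ (x∈p∩q⁻ r q x∈r∩q))))

x∈r∧x∈p∧x∉q⇒∣r∩q∣<∣r∩p∣+∣r∩[q─p]∣ : x ∈ r → x ∈ p → x ∉ q → ∣ r ∩ q ∣ < ∣ r ∩ p ∣ + ∣ r ∩ (q ─ p) ∣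
x∈r∧x∈p∧x∉q⇒∣r∩q∣<∣r∩p∣+∣r∩[q─p]∣ {r = r} {p = p} {q = q} x∈r x∈p x∉q =
  <-≤-trans (p⊂q⇒∣p∣<∣q∣ r∩q⊂cover) (∣p∪q∣≤∣p∣+∣q∣ (r ∩ p) (r ∩ (q ─ p)))
  where
  r∩q⊂cover : r ∩ q ⊂ (r ∩ p) ∪ (r ∩ (q ─ p))
  r∩q⊂cover = r∩q⊆cover , _ , x∈p∪q⁺ (inj₁ (x∈p∩q⁺ (x∈r , x∈p))) , x∉q ∘ proj₂ ∘ x∈p∩q⁻ r q
    where
    r∩q⊆cover : r ∩ q ⊆ (r ∩ p) ∪ (r ∩ (q ─ p))
    r∩q⊆cover {y} y∈r∩q with x∈p∩q⁻ r q y∈r∩q | y ∈? p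
    ... | y∈r , _   | yes y∈p = x∈p∪q⁺ (inj₁ (x∈p∩q⁺ (y∈r , y∈p)))
    ... | y∈r , y∈q | no  y∉p = x∈p∪q⁺ (inj₂ (x∈p∩q⁺ (y∈r , x∈p∧x∉q⇒x∈p─q y∈q y∉p)))

∣r∩p∣≤1+∣r∩[p-x]∣ : ∀ (r p : Subset n) x → ∣ r ∩ p ∣ ≤ suc ∣ r ∩ (p - x) ∣
∣r∩p∣≤1+∣r∩[p-x]∣ r p x = begin
  ∣ r ∩ p ∣                      ≤⟨ p⊆q⇒∣p∣≤∣q∣ r∩p⊆cover ⟩
  ∣ ⁅ x ⁆ ∪ (r ∩ (p - x)) ∣      ≤⟨ ∣p∪q∣≤∣p∣+∣q∣ ⁅ x ⁆ (r ∩ (p - x)) ⟩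
  ∣ ⁅ x ⁆ ∣ + ∣ r ∩ (p - x) ∣    ≡⟨ cong (_+ ∣ r ∩ (p - x) ∣) (∣⁅x⁆∣≡1 x) ⟩
  suc ∣ r ∩ (p - x) ∣            ∎
  where
  open ≤-Reasoning
  r∩p⊆cover : r ∩ p ⊆ ⁅ x ⁆ ∪ (r ∩ (p - x))
  r∩p⊆cover {y} y∈r∩p with x∈p∩q⁻ r p y∈r∩p | y ≟ x
  ... | _         | yes refl = x∈p∪q⁺ (inj₁ (x∈⁅x⁆ x))
  ... | y∈r , y∈p | no  y≢x  = x∈p∪q⁺ (inj₂ (x∈p∩q⁺ (y∈r , x∈p∧x≢y⇒x∈p-y y∈p y≢x)))

x∉r⇒∣r∩p∣≤∣r∩[p-x]∣ : ∀ (r p : Subset n) → x ∉ r → ∣ r ∩ p ∣ ≤ ∣ r ∩ (p - x) ∣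
x∉r⇒∣r∩p∣≤∣r∩[p-x]∣ {x = x} r p x∉r = p⊆q⇒∣p∣≤∣q∣ r∩p⊆r∩[p-x]
  where
  r∩p⊆r∩[p-x] : r ∩ p ⊆ r ∩ (p - x)
  r∩p⊆r∩[p-x] y∈r∩p =
    let y∈r , y∈p = x∈p∩q⁻ r p y∈r∩p
    in x∈p∩q⁺ (y∈r , x∈p∧x≢y⇒x∈p-y y∈p λ { refl → x∉r y∈r })

m≤n∧n+o≤m⇒n≡m×o≡0 : ∀ {m n o} → m ≤ n → n + o ≤ m → n ≡ m × o ≡ 0
m≤n∧n+o≤m⇒n≡m×o≡0 {m} {n} {o} m≤n n+o≤m =
  ≤-antisym (≤-trans (m≤m+n n o) n+o≤m) m≤n ,
  n≤0⇒n≡0 (+-cancelˡ-≤ n o 0 (≤-trans n+o≤m (≤-trans m≤n (≤-reflexive (sym (+-identityʳ n))))))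

n/2+n/2≤n : ∀ n → n / 2 + n / 2 ≤ n
n/2+n/2≤n n = subst (_≤ n) (trans (*-comm (n / 2) 2) (cong (n / 2 +_) (+-identityʳ (n / 2)))) (m/n*n≤m n 2)

∈-map⇔ : ∀ {a} {A : Set a} {m} (f : A → Bool) (xs : Vec A m) {j} → j ∈ map f xs ⇔ T (f (lookup xs j))
∈-map⇔ f xs {j} = mk⇔
  (λ j∈ → from T-≡ (trans (sym (lookup-map j f xs)) ([]=⇒lookup j∈)))
  (λ t → lookup⇒[]= j (map f xs) (trans (lookup-map j f xs) (to T-≡ t)))

module _ {m n} (M : BMat m n) {j : Fin m} where

  ∈-outcome⇔ : ∀ {x u} → j ∈ outcome M x u ⇔ u ≤ ∣ lookup M j ∩ x ∣
  ∈-outcome⇔ {x} {u} = mk⇔ (≤ᵇ⇒≤ u _ ∘ to (∈-map⇔ _ M)) (from (∈-map⇔ _ M) ∘ ≤⇒≤ᵇ)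

  ∈-goodRows⇔ : ∀ {u S Z i} →
    j ∈ goodRows M u S Z i ⇔ (∣ lookup M j ∩ S ∣ ≡ u × ∣ lookup M j ∩ Z ∣ ≡ 0 × i ∈ lookup M j)
  ∈-goodRows⇔ {u} {S} {Z} {i} = mk⇔ split (from (∈-map⇔ _ M) ∘ join)
    where
    row : Subset n
    row = lookup M j
    split : j ∈ goodRows M u S Z i → ∣ row ∩ S ∣ ≡ u × ∣ row ∩ Z ∣ ≡ 0 × i ∈ row
    split j∈ =
      let tS , tZi = to T-∧ (to (∈-map⇔ _ M) j∈)
          tZ , ti  = to T-∧ tZi
      in ≡ᵇ⇒≡ _ _ tS , ≡ᵇ⇒≡ _ _ tZ , lookup⇒[]= i row (to T-≡ ti)
    join : ∣ row ∩ S ∣ ≡ u × ∣ row ∩ Z ∣ ≡ 0 × i ∈ row → T ((∣ row ∩ S ∣ ≡ᵇ u) ∧ ((∣ row ∩ Z ∣ ≡ᵇ 0) ∧ lookup row i))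
    join (∣row∩S∣≡u , ∣row∩Z∣≡0 , i∈row) =
      from T-∧ (≡⇒≡ᵇ _ _ ∣row∩S∣≡u , from T-∧ (≡⇒≡ᵇ _ _ ∣row∩Z∣≡0 , from T-≡ ([]=⇒lookup i∈row)))

module _ {m n} (d e u : ℕ) (M : BMat m n) where

  disjunct⇒separating : Disjunct d e u M → Separating d e u M
  disjunct⇒separating disjunct x x′ x-sparse _ _ x⊈x′ ∣x′─x∣≤∣x∣ u≤∣x∣ =
    <-≤-trans (disjunct x (x′ ─ x) u≤∣x∣ x-sparse ∣x′─x∣≤∣x∣ (p∩[q─p]≡⊥ x x′) i i∈x)
              (p⊆q⇒∣p∣≤∣q∣ good⊆separated)
    where
    i : Fin n
    i = proj₁ (⊈-witness x⊈x′)
    i∈x : i ∈ x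
    i∈x = proj₁ (proj₂ (⊈-witness x⊈x′))
    i∉x′ : i ∉ x′
    i∉x′ = proj₂ (proj₂ (⊈-witness x⊈x′))

    good⊆separated : goodRows M u x (x′ ─ x) i ⊆ outcome M x u ─ outcome M x′ u
    good⊆separated {j} j∈good = from ∈─⇔ (from (∈-outcome⇔ M) (≤-reflexive (sym ∣row∩x∣≡u)) , x′-missed)
      where
      row : Subset n
      row = lookup M j
      ∣row∩x∣≡u : ∣ row ∩ x ∣ ≡ u
      ∣row∩x∣≡u = proj₁ (to (∈-goodRows⇔ M) j∈good)
      ∣row∩[x′─x]∣≡0 : ∣ row ∩ (x′ ─ x) ∣ ≡ 0
      ∣row∩[x′─x]∣≡0 = proj₁ (proj₂ (to (∈-goodRows⇔ M) j∈good))
      i∈row : i ∈ row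
      i∈row = proj₂ (proj₂ (to (∈-goodRows⇔ M) j∈good))
      ∣row∩x′∣<u : ∣ row ∩ x′ ∣ < u
      ∣row∩x′∣<u = subst (∣ row ∩ x′ ∣ <_) (trans (cong₂ _+_ ∣row∩x∣≡u ∣row∩[x′─x]∣≡0) (+-identityʳ u))
                         (x∈r∧x∈p∧x∉q⇒∣r∩q∣<∣r∩p∣+∣r∩[q─p]∣ i∈row i∈x i∉x′)
      x′-missed : j ∉ outcome M x′ u
      x′-missed = <⇒≱ ∣row∩x′∣<u ∘ to (∈-outcome⇔ M)

  separating⇒disjunct : Separating d e u M → Disjunct (d / 2) e u M
  separating⇒disjunct separating S Z u≤∣S∣ ∣S∣≤d/2 ∣Z∣≤∣S∣ S∩Z≡⊥ i i∈S =
    <-≤-trans (separating S x′ S-sparse x′-sparse S≢x′ S⊈x′ (≤-trans (p⊆q⇒∣p∣≤∣q∣ x′─S⊆Z) ∣Z∣≤∣S∣) u≤∣S∣)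
              (p⊆q⇒∣p∣≤∣q∣ separated⊆good)
    where
    x′ : Subset n
    x′ = (S ∪ Z) - i

    i∉x′ : i ∉ x′
    i∉x′ i∈x′ = proj₂ (to ∈─⇔ i∈x′) (x∈⁅x⁆ i)

    S-sparse : ∣ S ∣ ≤ d
    S-sparse = ≤-trans ∣S∣≤d/2 (m/n≤m d 2)

    x′-sparse : ∣ x′ ∣ ≤ d
    x′-sparse = begin
      ∣ (S ∪ Z) - i ∣    ≤⟨ ∣p─q∣≤∣p∣ (S ∪ Z) ⁅ i ⁆ ⟩
      ∣ S ∪ Z ∣          ≤⟨ ∣p∪q∣≤∣p∣+∣q∣ S Z ⟩
      ∣ S ∣ + ∣ Z ∣      ≤⟨ +-monoʳ-≤ ∣ S ∣ ∣Z∣≤∣S∣ ⟩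
      ∣ S ∣ + ∣ S ∣      ≤⟨ +-mono-≤ ∣S∣≤d/2 ∣S∣≤d/2 ⟩
      d / 2 + d / 2      ≤⟨ n/2+n/2≤n d ⟩
      d                  ∎
      where open ≤-Reasoning

    S≢x′ : S ≢ x′
    S≢x′ S≡x′ = i∉x′ (subst (i ∈_) S≡x′ i∈S)

    S⊈x′ : S ⊈ x′
    S⊈x′ S⊆x′ = i∉x′ (S⊆x′ i∈S)

    x′─S⊆Z : x′ ─ S ⊆ Z
    x′─S⊆Z y∈x′─S =
      let y∈x′ , y∉S = to ∈─⇔ y∈x′─S
      in [ flip contradiction y∉S , id ] (x∈p∪q⁻ S Z (proj₁ (to ∈─⇔ y∈x′)))

    separated⊆good : outcome M S u ─ outcome M x′ u ⊆ goodRows M u S Z i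
    separated⊆good {j} j∈separated = from (∈-goodRows⇔ M) (∣row∩S∣≡u , ∣row∩Z∣≡0 , i∈row)
      where
      row : Subset n
      row = lookup M j
      u≤∣row∩S∣ : u ≤ ∣ row ∩ S ∣
      u≤∣row∩S∣ = to (∈-outcome⇔ M) (proj₁ (to ∈─⇔ j∈separated))
      ∣row∩x′∣<u : ∣ row ∩ x′ ∣ < u
      ∣row∩x′∣<u = ≰⇒> (proj₂ (to ∈─⇔ j∈separated) ∘ from (∈-outcome⇔ M))
      ∣row∩S∣+∣row∩Z∣≡∣row∩[S∪Z]∣ : ∣ row ∩ S ∣ + ∣ row ∩ Z ∣ ≡ ∣ row ∩ (S ∪ Z) ∣
      ∣row∩S∣+∣row∩Z∣≡∣row∩[S∪Z]∣ = p∩q≡⊥⇒∣r∩p∣+∣r∩q∣≡∣r∩[p∪q]∣ row S Z S∩Z≡⊥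
      i∈row : i ∈ row
      i∈row = decidable-stable (i ∈? row) λ i∉row → <⇒≱ ∣row∩x′∣<u (begin
        u                          ≤⟨ u≤∣row∩S∣ ⟩
        ∣ row ∩ S ∣                ≤⟨ m≤m+n _ _ ⟩
        ∣ row ∩ S ∣ + ∣ row ∩ Z ∣  ≡⟨ ∣row∩S∣+∣row∩Z∣≡∣row∩[S∪Z]∣ ⟩
        ∣ row ∩ (S ∪ Z) ∣          ≤⟨ x∉r⇒∣r∩p∣≤∣r∩[p-x]∣ row (S ∪ Z) i∉row ⟩
        ∣ row ∩ x′ ∣               ∎)
        where open ≤-Reasoning
      ∣row∩S∣+∣row∩Z∣≤u : ∣ row ∩ S ∣ + ∣ row ∩ Z ∣ ≤ u
      ∣row∩S∣+∣row∩Z∣≤u = begin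
        ∣ row ∩ S ∣ + ∣ row ∩ Z ∣  ≡⟨ ∣row∩S∣+∣row∩Z∣≡∣row∩[S∪Z]∣ ⟩
        ∣ row ∩ (S ∪ Z) ∣          ≤⟨ ∣r∩p∣≤1+∣r∩[p-x]∣ row (S ∪ Z) i ⟩
        suc ∣ row ∩ x′ ∣           ≤⟨ ∣row∩x′∣<u ⟩
        u                          ∎
        where open ≤-Reasoning
      ∣row∩S∣≡u : ∣ row ∩ S ∣ ≡ u
      ∣row∩S∣≡u = proj₁ (m≤n∧n+o≤m⇒n≡m×o≡0 u≤∣row∩S∣ ∣row∩S∣+∣row∩Z∣≤u)
      ∣row∩Z∣≡0 : ∣ row ∩ Z ∣ ≡ 0
      ∣row∩Z∣≡0 = proj₂ (m≤n∧n+o≤m⇒n≡m×o≡0 u≤∣row∩S∣ ∣row∩S∣+∣row∩Z∣≤u)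

lemma5 : ∀ {m n} (d e u : ℕ) (M : BMat m n) →
    (Disjunct d e u M → Separating d e u M) × (Separating d e u M → Disjunct (d / 2) e u M)
lemma5 d e u M = disjunct⇒separating d e u M , separating⇒disjunct d e u M
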